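{- There is a first-order sentence $\psi$ which is preserved under extensions on finite $\mathbb{N}$-interpretations, but which is not equivalent on finite $\mathbb{N}$-interpretations to any $\phi\in\Sigma_1$, i.e. for every $\phi\in\Sigma_1$ there is a finite model-defining $\mathbb{N}$-interpretation $\pi$ with $\pi[\![\phi]\!]\ne\pi[\![\psi]\!]$.
   Context: $\mathbb{N}=(\mathbb{N},+,\cdot,0,1)$ with its usual order as natural order. Fix a relational vocabulary $\tau$. For a finite nonempty set $A$, $\mathrm{Lit}_A(\tau)$ is the set of literals $R\bar a,\neg R\bar a$ with $\bar a$ from $A$. An $\mathbb{N}$-interpretation over $A$ is $\pi:\mathrm{Lit}_A(\tau)\to\mathbb{N}$, model-defining if for each atom $R\bar a$ exactly one of $\pi(R\bar a),\pi(\neg R\bar a)$ is $0$. First-order formulas with equality in negation normal form are evaluated by: literals via $\pi$; (in)equalities by Boolean value $1$/$0$; $\vee$ by $+$, $\wedge$ by $\cdot$, $\exists x$ by sum over $A$, $\forall x$ by product over $A$. $\pi_A\subseteq\pi_B$ means $A\subseteq B$ and $\pi_A(L)=\pi_B(L)$ for literals over $A$. $\psi$ is preserved under extensions on finite $\mathbb{N}$-interpretations if $\pi_A[\![\psi]\!]\le\pi_B[\![\psi]\!]$ for all finite model-defining $\pi_A\subseteq\pi_B$. $\Sigma_1$: sentences $\exists\bar x\,\phi(\bar x)$ with $\phi$ quantifier-free. -}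

module Defs where

open import Data.Nat using (ℕ; zero; suc; _+_; _*_; _≤_)
open import Data.Fin using (Fin; zero; suc)
open import Data.Bool using (Bool; true; false)
open import Data.Product using (Σ; _×_; _,_)
open import Data.Sum using (_⊎_)
open import Relation.Nullary using (¬_)
open import Relation.Binary.PropositionalEquality using (_≡_)
open import Function using (_∘_)
open import Function.Definitions using (Injective)

record Vocabulary : Set₁ where
  field
    Sym   : Set
    arity : Sym → ℕ
open Vocabulary public

-- N-interpretation over the finite set A = Fin k.
-- π R ā true  = value of the positive literal R ā,
-- π R ā false = value of the negative literal ¬ R ā.
Interp : Vocabulary → ℕ → Set
Interp τ k = (R : Sym τ) → (Fin (arity τ R) → Fin k) → Bool → ℕ

ModelDefining : ∀ {τ k} → Interp τ k → Set
ModelDefining {τ} {k} π =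
  (R : Sym τ) (as : Fin (arity τ R) → Fin k) →
    ((π R as true ≡ 0) × ¬ (π R as false ≡ 0))
  ⊎ (¬ (π R as true ≡ 0) × (π R as false ≡ 0))

-- First-order formulas in negation normal form, with n free variables
-- (de Bruijn indices).  lit true = positive literal, lit false = negated.
data Formula (τ : Vocabulary) : ℕ → Set where
  lit  : ∀ {n} → Bool → (R : Sym τ) → (Fin (arity τ R) → Fin n) → Formula τ n
  eq   : ∀ {n} → Fin n → Fin n → Formula τ n
  neq  : ∀ {n} → Fin n → Fin n → Formula τ n
  _∨_  : ∀ {n} → Formula τ n → Formula τ n → Formula τ n
  _∧_  : ∀ {n} → Formula τ n → Formula τ n → Formula τ n
  ex   : ∀ {n} → Formula τ (suc n) → Formula τ n
  all  : ∀ {n} → Formula τ (suc n) → Formula τ n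

Sentence : Vocabulary → Set
Sentence τ = Formula τ 0

data IsQF {τ : Vocabulary} : ∀ {n} → Formula τ n → Set where
  lit : ∀ {n} b R (xs : Fin (arity τ R) → Fin n) → IsQF (lit b R xs)
  eq  : ∀ {n} (x y : Fin n) → IsQF (eq {τ} x y)
  neq : ∀ {n} (x y : Fin n) → IsQF (neq {τ} x y)
  _∨_ : ∀ {n} {φ ψ : Formula τ n} → IsQF φ → IsQF ψ → IsQF (φ ∨ ψ)
  _∧_ : ∀ {n} {φ ψ : Formula τ n} → IsQF φ → IsQF ψ → IsQF (φ ∧ ψ)

exs : ∀ {τ n} (m : ℕ) → Formula τ (m + n) → Formula τ n
exs zero    φ = φ
exs (suc m) φ = exs m (ex φ)

IsΣ₁ : ∀ {τ} → Sentence τ → Set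
IsΣ₁ {τ} θ = Σ ℕ λ m → Σ (Formula τ (m + 0)) λ φ → IsQF φ × (θ ≡ exs m φ)

sumFin : ∀ k → (Fin k → ℕ) → ℕ
sumFin zero    f = 0
sumFin (suc k) f = f zero + sumFin k (f ∘ suc)

prodFin : ∀ k → (Fin k → ℕ) → ℕ
prodFin zero    f = 1
prodFin (suc k) f = f zero * prodFin k (f ∘ suc)

extend : ∀ {k n} → Fin k → (Fin n → Fin k) → Fin (suc n) → Fin k
extend a ρ zero    = a
extend a ρ (suc i) = ρ i

bool : ∀ {k} → Fin k → Fin k → Bool → ℕ
bool a b want with Data.Fin._≟_ a b
  where import Data.Fin
... | Relation.Nullary.yes _ = if-true want
  where if-true : Bool → ℕ
        if-true true = 1
        if-true false = 0
... | Relation.Nullary.no _ = if-false want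
  where if-false : Bool → ℕ
        if-false true = 0
        if-false false = 1

eval : ∀ {τ k n} → Interp τ k → Formula τ n → (Fin n → Fin k) → ℕ
eval π (lit b R xs) ρ = π R (ρ ∘ xs) b
eval π (eq x y)     ρ = bool (ρ x) (ρ y) true
eval π (neq x y)    ρ = bool (ρ x) (ρ y) false
eval π (φ ∨ ψ)      ρ = eval π φ ρ + eval π ψ ρ
eval π (φ ∧ ψ)      ρ = eval π φ ρ * eval π ψ ρ
eval {k = k} π (ex φ)  ρ = sumFin k (λ a → eval π φ (extend a ρ))
eval {k = k} π (all φ) ρ = prodFin k (λ a → eval π φ (extend a ρ))

evalS : ∀ {τ k} → Interp τ k → Sentence τ → ℕ
evalS π φ = eval π φ (λ ())

SubInterp : ∀ {τ m n} → Interp τ m → Interp τ n → (Fin m → Fin n) → Set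
SubInterp {τ} {m} πA πB f =
  Injective _≡_ _≡_ f ×
  ((R : Sym τ) (as : Fin (arity τ R) → Fin m) (b : Bool) → πA R as b ≡ πB R (f ∘ as) b)

PreservedUnderExtensions : ∀ {τ} → Sentence τ → Set
PreservedUnderExtensions {τ} ψ =
  (m n : ℕ) (πA : Interp τ (suc m)) (πB : Interp τ (suc n)) (f : Fin (suc m) → Fin (suc n)) →
  ModelDefining πA → ModelDefining πB → SubInterp πA πB f →
  evalS πA ψ ≤ evalS πB ψ

-- Take ψ = ∀x ∃y (y = y).  On a universe of size k it evaluates to k ^ k in every
-- interpretation, so preservation under extensions is monotonicity of k ↦ k ^ k.
-- In the interpretation where every positive literal is 0 and every negative
-- literal is 1, a quantifier-free formula φ is bounded by a constant B depending
-- only on its syntax, so ∃x₁…∃xₘ φ is at most k ^ m * B, which is below k ^ k as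
-- soon as k > m + B.
module Submission where

open import Defs
open import Data.Nat using (ℕ; zero; suc; _+_; _*_; _^_; _≤_; _<_; z≤n; s≤s; >-nonZero)
open import Data.Nat.Properties
  using ( ≤-refl; ≤-trans; ≤-<-trans; <-irrefl; module ≤-Reasoning; +-mono-≤; *-mono-≤
        ; *-monoʳ-<; +-identityʳ; *-identityʳ; *-assoc; *-comm; m≤m+n; m≤n+m
        ; m^n>0; ^-monoˡ-≤; ^-monoʳ-≤ )
open import Data.Fin using (Fin; zero; suc; _≟_)
open import Data.Fin.Properties using (injective⇒≤)
open import Data.Bool using (true; false)
open import Data.Product using (Σ; _×_; _,_)
open import Data.Sum using (inj₁)
open import Relation.Nullary using (¬_; yes; no)
open import Relation.Binary.PropositionalEquality
  using (_≡_; refl; sym; trans; cong; cong₂; subst; module ≡-Reasoning)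
open import Data.Empty using (⊥-elim)
open import Function using (_∘_)

bool-refl : ∀ {k} (a : Fin k) → bool a a true ≡ 1
bool-refl a with a ≟ a
... | yes _ = refl
... | no a≢a = ⊥-elim (a≢a refl)

bool≤1 : ∀ {k} (a b : Fin k) w → bool a b w ≤ 1
bool≤1 a b w with a ≟ b
bool≤1 a b true  | yes _ = ≤-refl
bool≤1 a b false | yes _ = z≤n
bool≤1 a b true  | no _  = z≤n
bool≤1 a b false | no _  = ≤-refl

sumFin-const : ∀ k {f : Fin k → ℕ} {c} → (∀ a → f a ≡ c) → sumFin k f ≡ k * c
sumFin-const zero    f≡c = refl
sumFin-const (suc k) f≡c = cong₂ _+_ (f≡c zero) (sumFin-const k (f≡c ∘ suc))

prodFin-const : ∀ k {f : Fin k → ℕ} {c} → (∀ a → f a ≡ c) → prodFin k f ≡ c ^ k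
prodFin-const zero    f≡c = refl
prodFin-const (suc k) f≡c = cong₂ _*_ (f≡c zero) (prodFin-const k (f≡c ∘ suc))

sumFin-≤-const : ∀ k {f : Fin k → ℕ} {B} → (∀ a → f a ≤ B) → sumFin k f ≤ k * B
sumFin-≤-const zero    f≤B = z≤n
sumFin-≤-const (suc k) f≤B = +-mono-≤ (f≤B zero) (sumFin-≤-const k (f≤B ∘ suc))

n^n-mono-≤ : ∀ {m n} → m ≤ n → m ^ m ≤ n ^ n
n^n-mono-≤ {n = zero}  z≤n = ≤-refl
n^n-mono-≤ {n = suc n} z≤n = m^n>0 (suc n) (suc n)
n^n-mono-≤ {suc m} {suc n} m≤n =
  ≤-trans (^-monoˡ-≤ (suc m) m≤n) (^-monoʳ-≤ (suc n) m≤n)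

k^m*B<k^k : ∀ {k m B} → m < k → B < k → k ^ m * B < k ^ k
k^m*B<k^k {suc k} {m} {B} m<k B<k = begin-strict
  suc k ^ m * B       <⟨ *-monoʳ-< (suc k ^ m) {{>-nonZero (m^n>0 (suc k) m)}} B<k ⟩
  suc k ^ m * suc k   ≡⟨ *-comm (suc k ^ m) (suc k) ⟩
  suc k ^ suc m       ≤⟨ ^-monoʳ-≤ (suc k) m<k ⟩
  suc k ^ suc k       ∎
  where open ≤-Reasoning

module _ {τ : Vocabulary} where

  everyElementExists : Sentence τ
  everyElementExists = all (ex (eq zero zero))

  evalS-everyElementExists : ∀ {k} (π : Interp τ k) → evalS π everyElementExists ≡ k ^ k
  evalS-everyElementExists {k} π = prodFin-const k λ _ →
    trans (sumFin-const k bool-refl) (*-identityʳ k)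

  everyElementExists-preserved : PreservedUnderExtensions everyElementExists
  everyElementExists-preserved m n πA πB f _ _ (f-injective , _)
    rewrite evalS-everyElementExists πA | evalS-everyElementExists πB =
    n^n-mono-≤ (injective⇒≤ f-injective)

  allFalse : ∀ {k} → Interp τ k
  allFalse R as true  = 0
  allFalse R as false = 1

  allFalse-modelDefining : ∀ {k} → ModelDefining (allFalse {k})
  allFalse-modelDefining R as = inj₁ (refl , λ ())

  IsBoolean : ∀ {k} → Interp τ k → Set
  IsBoolean π = ∀ R as b → π R as b ≤ 1

  allFalse-isBoolean : ∀ {k} → IsBoolean (allFalse {k})
  allFalse-isBoolean R as true  = z≤n
  allFalse-isBoolean R as false = ≤-refl

  qfBound : ∀ {n} {φ : Formula τ n} → IsQF φ → ℕ
  qfBound (lit b R xs) = 1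
  qfBound (eq x y)     = 1
  qfBound (neq x y)    = 1
  qfBound (p ∨ q)      = qfBound p + qfBound q
  qfBound (p ∧ q)      = qfBound p * qfBound q

  eval-qf-≤ : ∀ {k n} {π : Interp τ k} → IsBoolean π →
              {φ : Formula τ n} (q : IsQF φ) (ρ : Fin n → Fin k) → eval π φ ρ ≤ qfBound q
  eval-qf-≤ π≤1 (lit b R xs) ρ = π≤1 R (ρ ∘ xs) b
  eval-qf-≤ π≤1 (eq x y)     ρ = bool≤1 (ρ x) (ρ y) true
  eval-qf-≤ π≤1 (neq x y)    ρ = bool≤1 (ρ x) (ρ y) false
  eval-qf-≤ π≤1 (p ∨ q)      ρ = +-mono-≤ (eval-qf-≤ π≤1 p ρ) (eval-qf-≤ π≤1 q ρ)
  eval-qf-≤ π≤1 (p ∧ q)      ρ = *-mono-≤ (eval-qf-≤ π≤1 p ρ) (eval-qf-≤ π≤1 q ρ)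

  eval-exs-≤ : ∀ {k} {π : Interp τ k} m {n} {φ : Formula τ (m + n)} {B} →
               (∀ ρ → eval π φ ρ ≤ B) → ∀ ρ → eval π (exs m φ) ρ ≤ k ^ m * B
  eval-exs-≤ {π = π} zero {φ = φ} {B} φ≤B ρ = subst (eval π φ ρ ≤_) (sym (+-identityʳ B)) (φ≤B ρ)
  eval-exs-≤ {k} {π} (suc m) {φ = φ} {B} φ≤B ρ =
    subst (eval π (exs m (ex φ)) ρ ≤_) k^m*[k*B]≡k^[1+m]*B
      (eval-exs-≤ m {φ = ex φ} (λ ρ′ → sumFin-≤-const k (λ a → φ≤B (extend a ρ′))) ρ)
    where
    open ≡-Reasoning
    k^m*[k*B]≡k^[1+m]*B : k ^ m * (k * B) ≡ k ^ suc m * B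
    k^m*[k*B]≡k^[1+m]*B = begin
      k ^ m * (k * B)   ≡⟨ *-assoc (k ^ m) k B ⟨
      k ^ m * k * B     ≡⟨ cong (_* B) (*-comm (k ^ m) k) ⟩
      k * k ^ m * B     ∎

  Σ₁-separated : (φ : Sentence τ) → IsΣ₁ φ →
    Σ ℕ λ k → Σ (Interp τ (suc k)) λ π →
      ModelDefining π × ¬ (evalS π φ ≡ evalS π everyElementExists)
  Σ₁-separated .(exs m φ) (m , φ , q , refl) =
    m + B , π , allFalse-modelDefining , φ≢ψ
    where
    B = qfBound q
    k = suc (m + B)
    π : Interp τ k
    π = allFalse
    φ≤ : evalS π (exs m φ) ≤ k ^ m * B
    φ≤ = eval-exs-≤ m (eval-qf-≤ allFalse-isBoolean q) _
    φ<ψ : evalS π (exs m φ) < evalS π everyElementExists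
    φ<ψ = subst (evalS π (exs m φ) <_) (sym (evalS-everyElementExists π))
      (≤-<-trans φ≤ (k^m*B<k^k (s≤s (m≤m+n m B)) (s≤s (m≤n+m B m))))
    φ≢ψ : ¬ (evalS π (exs m φ) ≡ evalS π everyElementExists)
    φ≢ψ φ≡ψ = <-irrefl φ≡ψ φ<ψ

mainTheorem3 : (τ : Vocabulary) →
    Σ (Sentence τ) λ ψ →
    PreservedUnderExtensions ψ ×
    ((φ : Sentence τ) → IsΣ₁ φ →
    Σ ℕ λ k → Σ (Interp τ (suc k)) λ π →
    ModelDefining π × ¬ (evalS π φ ≡ evalS π ψ))
mainTheorem3 τ = everyElementExists , everyElementExists-preserved , Σ₁-separated
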